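{- Let $G$ be a $C_4$-free graph on $n$ vertices with $\delta(G)\le \frac{11n}{15}$. Then $\omega(G)\ge \delta(G)-\frac{n}{3}$.
   Context: All graphs are finite and simple. A graph is called $C_4$-free if it does not contain the cycle on four vertices as an induced subgraph. $\omega(G)$ denotes the maximum size of a clique in $G$, and $\delta(G)$ denotes the minimum degree of $G$. -}

module Defs where

open import Data.Nat using (ℕ; _≤_)
open import Data.Fin using (Fin)
open import Data.Fin.Subset using (Subset; _∈_; ∣_∣)
open import Data.List using (length; filter; allFin)
open import Data.Product using (Σ; _×_; ∃)
open import Data.Empty using (⊥)
open import Relation.Nullary using (¬_; Dec)
open import Relation.Binary.PropositionalEquality using (_≡_; _≢_)

record Graph (n : ℕ) : Set₁ where
  field
    Adj     : Fin n → Fin n → Set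
    adj?    : ∀ u v → Dec (Adj u v)
    symm    : ∀ {u v} → Adj u v → Adj v u
    irrefl  : ∀ {u} → ¬ Adj u u

open Graph public

degree : ∀ {n} (G : Graph n) → Fin n → ℕ
degree {n} G v = length (filter (adj? G v) (allFin n))

IsMinDegree : ∀ {n} → Graph n → ℕ → Set
IsMinDegree G d = (∀ v → d ≤ degree G v) × ∃ (λ v → degree G v ≡ d)

IsClique : ∀ {n} → Graph n → Subset n → Set
IsClique G S = ∀ {u v} → u ∈ S → v ∈ S → u ≢ v → Adj G u v

IsCliqueNumber : ∀ {n} → Graph n → ℕ → Set
IsCliqueNumber G w =
  Σ _ (λ S → IsClique G S × ∣ S ∣ ≡ w) × (∀ S → IsClique G S → ∣ S ∣ ≤ w)

C4Free : ∀ {n} → Graph n → Set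
C4Free G = ∀ a b c d →
  Adj G a b → Adj G b c → Adj G c d → Adj G d a →
  a ≢ c → b ≢ d → ¬ Adj G a c → ¬ Adj G b d → ⊥

module Submission where

-- In a C₄-free graph the common neighbourhood of two distinct
-- non-adjacent vertices is a clique (two non-adjacent common neighbours would
-- close an induced 4-cycle), so it has at most ω vertices.  Fix a vertex v of
-- minimum degree δ and let M be its set of non-neighbours (v included), so
-- |M| = n - δ.  For an outsider x ∈ M - v, splitting N(x) along N(v) gives
-- δ ≤ |N(x)| ≤ ω + d(x), where d(x) = |N(x) ∩ M| ≤ |M| - 2.
--   * If the outsiders form a clique, |M| ≤ ω + 1, hence δ ≤ 2ω and
--     3δ ≤ δ + (ω + |M|) + 2ω = 3ω + n.
--   * If two outsiders x, y are non-adjacent and 3·d(x) ≤ n (or 3·d(y) ≤ n),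
--     then 3δ ≤ 3ω + 3·d(x) ≤ 3ω + n.  Otherwise inclusion–exclusion inside M
--     gives d(x) + d(y) ≤ ω + |M| - 3, which together with 3·d(x), 3·d(y) ≥ n
--     and n = δ + |M| yields the bound.
--   * If there is no outsider, G must be complete, so ω = n ≥ δ.

open import Defs
open import Data.Nat using (ℕ; _≤_; _*_; _+_)
open import Data.Nat using (suc; s≤s; z≤n)
open import Data.Nat.Properties
open import Data.Nat.Tactic.RingSolver using (solve-∀)
open import Data.Fin using (Fin; zero; suc)
import Data.Fin.Properties as Fin
open import Data.Fin.Subset
open import Data.Fin.Subset.Properties
open import Data.Vec using ([]; _∷_; here; there)
open import Data.List using (List; []; _∷_; length; filter; tabulate)
open import Data.List.Relation.Unary.All using (All; []; _∷_)
import Data.List.Relation.Unary.All as All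
open import Data.List.Relation.Unary.AllPairs using ([]; _∷_)
open import Data.List.Relation.Unary.Unique.Propositional using (Unique)
open import Data.Empty using (⊥-elim)
open import Data.Product using (_×_; _,_; ∃₂; proj₁; proj₂)
open import Data.Sum using (_⊎_; inj₁; inj₂)
open import Relation.Nullary using (¬_; Dec; yes; no; does; contradiction)
open import Relation.Nullary.Decidable using (_×-dec_; ¬?)
open import Relation.Binary.PropositionalEquality

-- Counting in finite subsets

subsetOf : ∀ {n} {P : Fin n → Set} → (∀ z → Dec (P z)) → Subset n
subsetOf {ℕ.zero} P? = []
subsetOf {suc n}  P? = does (P? zero) ∷ subsetOf (λ z → P? (suc z))

∈subsetOf⁺ : ∀ {n} {P : Fin n → Set} (P? : ∀ z → Dec (P z)) {z} → P z → z ∈ subsetOf P?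
∈subsetOf⁺ P? {zero} pz with P? zero
... | yes _   = here
... | no ¬pz  = contradiction pz ¬pz
∈subsetOf⁺ P? {suc z} pz = there (∈subsetOf⁺ (λ z → P? (suc z)) pz)

∈subsetOf⁻ : ∀ {n} {P : Fin n → Set} (P? : ∀ z → Dec (P z)) {z} → z ∈ subsetOf P? → P z
∈subsetOf⁻ P? {zero} z∈ with P? zero
∈subsetOf⁻ P? {zero} _  | yes pz = pz
∈subsetOf⁻ P? {zero} () | no _
∈subsetOf⁻ P? {suc z} (there z∈) = ∈subsetOf⁻ (λ z → P? (suc z)) z∈

length-filter-tabulate : ∀ {m n} {P : Fin n → Set} (P? : ∀ z → Dec (P z)) (g : Fin m → Fin n) →
  length (filter P? (tabulate g)) ≡ ∣ subsetOf (λ z → P? (g z)) ∣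
length-filter-tabulate {ℕ.zero} P? g = refl
length-filter-tabulate {suc m}  P? g with P? (g zero)
... | yes _ = cong suc (length-filter-tabulate P? (λ z → g (suc z)))
... | no _  = length-filter-tabulate P? (λ z → g (suc z))

∣p∩q∣+∣p∪q∣≡∣p∣+∣q∣ : ∀ {n} (p q : Subset n) → ∣ p ∩ q ∣ + ∣ p ∪ q ∣ ≡ ∣ p ∣ + ∣ q ∣
∣p∩q∣+∣p∪q∣≡∣p∣+∣q∣ []            []            = refl
∣p∩q∣+∣p∪q∣≡∣p∣+∣q∣ (inside  ∷ p) (inside  ∷ q) =
  cong suc (trans (+-suc _ _) (trans (cong suc (∣p∩q∣+∣p∪q∣≡∣p∣+∣q∣ p q)) (sym (+-suc _ _))))
∣p∩q∣+∣p∪q∣≡∣p∣+∣q∣ (inside  ∷ p) (outside ∷ q) =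
  trans (+-suc _ _) (cong suc (∣p∩q∣+∣p∪q∣≡∣p∣+∣q∣ p q))
∣p∩q∣+∣p∪q∣≡∣p∣+∣q∣ (outside ∷ p) (inside  ∷ q) =
  trans (+-suc _ _) (trans (cong suc (∣p∩q∣+∣p∪q∣≡∣p∣+∣q∣ p q)) (sym (+-suc _ _)))
∣p∩q∣+∣p∪q∣≡∣p∣+∣q∣ (outside ∷ p) (outside ∷ q) = ∣p∩q∣+∣p∪q∣≡∣p∣+∣q∣ p q

∣p∪q∣≤∣p∣+∣q∣ : ∀ {n} (p q : Subset n) → ∣ p ∪ q ∣ ≤ ∣ p ∣ + ∣ q ∣
∣p∪q∣≤∣p∣+∣q∣ p q = ≤-trans (m≤n+m ∣ p ∪ q ∣ ∣ p ∩ q ∣) (≤-reflexive (∣p∩q∣+∣p∪q∣≡∣p∣+∣q∣ p q))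

∣q∣≤∣p∩q∣+∣∁p∩q∣ : ∀ {n} (p q : Subset n) → ∣ q ∣ ≤ ∣ p ∩ q ∣ + ∣ ∁ p ∩ q ∣
∣q∣≤∣p∩q∣+∣∁p∩q∣ p q = ≤-trans (p⊆q⇒∣p∣≤∣q∣ split) (∣p∪q∣≤∣p∣+∣q∣ (p ∩ q) (∁ p ∩ q))
  where
  split : q ⊆ (p ∩ q) ∪ (∁ p ∩ q)
  split {z} z∈q with z ∈? p
  ... | yes z∈p = x∈p∪q⁺ (inj₁ (x∈p∩q⁺ (z∈p , z∈q)))
  ... | no  z∉p = x∈p∪q⁺ (inj₂ (x∈p∩q⁺ (x∉p⇒x∈∁p z∉p , z∈q)))

∣p∣+∣∁p∣≡n : ∀ {n} (p : Subset n) → ∣ p ∣ + ∣ ∁ p ∣ ≡ n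
∣p∣+∣∁p∣≡n {n} p = trans (cong (∣ p ∣ +_) (∣∁p∣≡n∸∣p∣ p)) (m+[n∸m]≡n (∣p∣≤n p))

x∉p-x : ∀ {n} (p : Subset n) (x : Fin n) → x ∉ p - x
x∉p-x (_ ∷ p) zero    ()
x∉p-x (_ ∷ p) (suc x) (there x∈) = x∉p-x p x x∈

x∈p-y⁺ : ∀ {n} {p : Subset n} {x y} → x ∈ p → x ≢ y → x ∈ p - y
x∈p-y⁺ {y = y} x∈p x≢y = x∈p∧x∉q⇒x∈p─q x∈p (λ x∈⁅y⁆ → x≢y (x∈⁅y⁆⇒x≡y y x∈⁅y⁆))

x∈p-y⁻ : ∀ {n} {p : Subset n} {x y} → x ∈ p - y → x ∈ p × x ≢ y
x∈p-y⁻ {p = p} {x} {y} x∈ = p─q⊆p p ⁅ y ⁆ x∈ , λ { refl → x∉p-x p x x∈ }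

∣p∣≤1+∣p-x∣ : ∀ {n} (p : Subset n) (x : Fin n) → ∣ p ∣ ≤ suc ∣ p - x ∣
∣p∣≤1+∣p-x∣ p x = begin
  ∣ p ∣                 ≤⟨ p⊆q⇒∣p∣≤∣q∣ cover ⟩
  ∣ (p - x) ∪ ⁅ x ⁆ ∣   ≤⟨ ∣p∪q∣≤∣p∣+∣q∣ (p - x) ⁅ x ⁆ ⟩
  ∣ p - x ∣ + ∣ ⁅ x ⁆ ∣ ≡⟨ cong (∣ p - x ∣ +_) (∣⁅x⁆∣≡1 x) ⟩
  ∣ p - x ∣ + 1         ≡⟨ +-comm ∣ p - x ∣ 1 ⟩
  suc ∣ p - x ∣         ∎
  where
  open ≤-Reasoning
  cover : p ⊆ (p - x) ∪ ⁅ x ⁆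
  cover {z} z∈p with z Fin.≟ x
  ... | yes refl = x∈p∪q⁺ (inj₂ (x∈⁅x⁆ x))
  ... | no  z≢x  = x∈p∪q⁺ (inj₁ (x∈p-y⁺ z∈p z≢x))

∣p∣+missing≤∣q∣ : ∀ {n} {p q : Subset n} (xs : List (Fin n)) → Unique xs →
  All (_∈ q) xs → All (_∉ p) xs → p ⊆ q → ∣ p ∣ + length xs ≤ ∣ q ∣
∣p∣+missing≤∣q∣ {p = p} [] _ _ _ p⊆q = ≤-trans (≤-reflexive (+-identityʳ ∣ p ∣)) (p⊆q⇒∣p∣≤∣q∣ p⊆q)
∣p∣+missing≤∣q∣ {p = p} {q} (x ∷ xs) (x≢xs ∷ uniq) (x∈q ∷ xs∈q) (x∉p ∷ xs∉p) p⊆q = begin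
  ∣ p ∣ + suc (length xs) ≡⟨ +-suc ∣ p ∣ (length xs) ⟩
  suc (∣ p ∣ + length xs) ≤⟨ s≤s (∣p∣+missing≤∣q∣ xs uniq xs∈q-x xs∉p p⊆q-x) ⟩
  suc ∣ q - x ∣           ≤⟨ x∈p⇒∣p-x∣<∣p∣ x∈q ⟩
  ∣ q ∣                   ∎
  where
  open ≤-Reasoning
  p⊆q-x : p ⊆ q - x
  p⊆q-x z∈p = x∈p-y⁺ (p⊆q z∈p) (λ { refl → x∉p z∈p })
  xs∈q-x : All (_∈ q - x) xs
  xs∈q-x = All.zipWith (λ (y∈q , x≢y) → x∈p-y⁺ y∈q (λ y≡x → x≢y (sym y≡x))) (xs∈q , x≢xs)

-- Arithmetic of the three cases (δ, ω, K, d stand for the minimum degree,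
-- clique number, number of non-neighbours of v and outer degrees).

bound-few-outer-neighbours : ∀ {n} δ ω d → δ ≤ ω + d → 3 * d ≤ n → 3 * δ ≤ 3 * ω + n
bound-few-outer-neighbours {n} δ ω d δ≤ω+d 3d≤n = begin
  3 * δ         ≤⟨ *-monoʳ-≤ 3 δ≤ω+d ⟩
  3 * (ω + d)   ≡⟨ *-distribˡ-+ 3 ω d ⟩
  3 * ω + 3 * d ≤⟨ +-monoʳ-≤ (3 * ω) 3d≤n ⟩
  3 * ω + n     ∎
  where open ≤-Reasoning

bound-two-outsiders : ∀ {n} δ ω K dx dy → δ + K ≡ n → n ≤ 3 * dx → n ≤ 3 * dy →
  dx + dy + 3 ≤ ω + K → 3 * δ ≤ 3 * ω + n
bound-two-outsiders δ ω K dx dy refl n≤3dx n≤3dy sum≤ =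
  +-cancelʳ-≤ (n + n) (3 * δ) (3 * ω + n) (begin
    3 * δ + (n + n)                 ≤⟨ +-monoʳ-≤ (3 * δ) (+-mono-≤ n≤3dx n≤3dy) ⟩
    3 * δ + (3 * dx + 3 * dy)       ≡⟨ cong (3 * δ +_) (sym (*-distribˡ-+ 3 dx dy)) ⟩
    3 * δ + 3 * (dx + dy)           ≤⟨ +-monoʳ-≤ (3 * δ) (*-monoʳ-≤ 3 dx+dy≤ω+K) ⟩
    3 * δ + 3 * (ω + K)             ≡⟨ regroup δ ω K ⟩
    (3 * ω + n) + (n + n)           ∎)
  where
  open ≤-Reasoning
  -- n abbreviates δ + K, as the first hypothesis forces.
  n : ℕ
  n = δ + K
  dx+dy≤ω+K : dx + dy ≤ ω + K
  dx+dy≤ω+K = ≤-trans (m≤m+n (dx + dy) 3) sum≤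
  regroup : ∀ δ ω K → 3 * δ + 3 * (ω + K) ≡ (3 * ω + (δ + K)) + ((δ + K) + (δ + K))
  regroup = solve-∀

-- The outsiders form a clique, so K ≤ ω + 1; an outsider with δ ≤ ω + d and
-- d ≤ K - 2 then gives δ ≤ 2ω as well as δ ≤ ω + K.
bound-clique-of-outsiders : ∀ {n} δ ω K d → δ + K ≡ n → δ ≤ ω + d → d + 2 ≤ K →
  K ≤ suc ω → 3 * δ ≤ 3 * ω + n
bound-clique-of-outsiders δ ω K d refl δ≤ω+d d+2≤K K≤1+ω = begin
  3 * δ                   ≡⟨ triple δ ⟩
  δ + (δ + δ)             ≤⟨ +-monoʳ-≤ δ (+-mono-≤ δ≤ω+K δ≤ω+ω) ⟩
  δ + ((ω + K) + (ω + ω)) ≡⟨ regroup δ ω K ⟩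
  3 * ω + (δ + K)         ∎
  where
  open ≤-Reasoning
  δ+2≤ω+K : δ + 2 ≤ ω + K
  δ+2≤ω+K = begin
    δ + 2       ≤⟨ +-monoˡ-≤ 2 δ≤ω+d ⟩
    ω + d + 2   ≡⟨ +-assoc ω d 2 ⟩
    ω + (d + 2) ≤⟨ +-monoʳ-≤ ω d+2≤K ⟩
    ω + K       ∎
  δ≤ω+K : δ ≤ ω + K
  δ≤ω+K = ≤-trans (m≤m+n δ 2) δ+2≤ω+K
  δ≤ω+ω : δ ≤ ω + ω
  δ≤ω+ω = ≤-trans (m≤m+n δ 1) (≤-pred (begin
    suc (δ + 1) ≡⟨ +-suc δ 1 ⟨
    δ + 2       ≤⟨ δ+2≤ω+K ⟩
    ω + K       ≤⟨ +-monoʳ-≤ ω K≤1+ω ⟩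
    ω + suc ω   ≡⟨ +-suc ω ω ⟩
    suc (ω + ω) ∎))
  triple : ∀ δ → 3 * δ ≡ δ + (δ + δ)
  triple = solve-∀
  regroup : ∀ δ ω K → δ + ((ω + K) + (ω + ω)) ≡ 3 * ω + (δ + K)
  regroup = solve-∀

-- Neighbourhoods and cliques

module _ {n} (G : Graph n) where

  N : Fin n → Subset n
  N u = subsetOf (adj? G u)

  degree≡∣N∣ : ∀ u → degree G u ≡ ∣ N u ∣
  degree≡∣N∣ u = length-filter-tabulate (adj? G u) (λ z → z)

  NonEdgeIn : Subset n → Set
  NonEdgeIn S = ∃₂ λ u w → u ∈ S × w ∈ S × u ≢ w × ¬ Adj G u w

  clique-or-nonEdge : (S : Subset n) → IsClique G S ⊎ NonEdgeIn S
  clique-or-nonEdge S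
    with Fin.any? (λ u → Fin.any? (λ w →
           (u ∈? S) ×-dec (w ∈? S) ×-dec ¬? (u Fin.≟ w) ×-dec ¬? (adj? G u w)))
  ... | yes (u , w , nonEdge) = inj₂ (u , w , nonEdge)
  ... | no noNonEdge = inj₁ isClique
    where
    isClique : IsClique G S
    isClique {u} {w} u∈S w∈S u≢w with adj? G u w
    ... | yes u~w = u~w
    ... | no  u≁w = contradiction (u , w , u∈S , w∈S , u≢w , u≁w) noNonEdge

  -- In a C₄-free graph the common neighbours of two distinct non-adjacent
  -- vertices are pairwise adjacent: otherwise they would span an induced C₄.
  commonNeighbours-isClique : C4Free G → ∀ {u w} → u ≢ w → ¬ Adj G u w →
    IsClique G (N u ∩ N w)
  commonNeighbours-isClique c4 {u} {w} u≢w u≁w {z₁} {z₂} z₁∈ z₂∈ z₁≢z₂ with adj? G z₁ z₂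
  ... | yes z₁~z₂ = z₁~z₂
  ... | no  z₁≁z₂ = ⊥-elim (c4 u z₁ w z₂ u~z₁ (symm G w~z₁) w~z₂ (symm G u~z₂) u≢w z₁≢z₂ u≁w z₁≁z₂)
    where
    neighbour : ∀ {x z} → z ∈ N x → Adj G x z
    neighbour {x} = ∈subsetOf⁻ (adj? G x)
    u~z₁ : Adj G u z₁
    u~z₁ = neighbour (proj₁ (x∈p∩q⁻ (N u) (N w) z₁∈))
    w~z₁ : Adj G w z₁
    w~z₁ = neighbour (proj₂ (x∈p∩q⁻ (N u) (N w) z₁∈))
    u~z₂ : Adj G u z₂
    u~z₂ = neighbour (proj₁ (x∈p∩q⁻ (N u) (N w) z₂∈))
    w~z₂ : Adj G w z₂
    w~z₂ = neighbour (proj₂ (x∈p∩q⁻ (N u) (N w) z₂∈))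

  ∉N : ∀ {u z} → ¬ Adj G u z → z ∉ N u
  ∉N {u} u≁z z∈ = u≁z (∈subsetOf⁻ (adj? G u) z∈)

-- The case analysis around a vertex v of minimum degree

module MinimumDegreeVertex {n} (G : Graph n) (δ ω : ℕ) (c4 : C4Free G)
         (md : IsMinDegree G δ) (cn : IsCliqueNumber G ω) where

  v : Fin n
  v = proj₁ (proj₂ md)

  -- The non-neighbours of v (v itself included); M - v are the outsiders.
  M : Subset n
  M = ∁ (N G v)

  K : ℕ
  K = ∣ M ∣

  δ+K≡n : δ + K ≡ n
  δ+K≡n = trans (cong (_+ K) δ≡∣Nv∣) (∣p∣+∣∁p∣≡n (N G v))
    where
    δ≡∣Nv∣ : δ ≡ ∣ N G v ∣
    δ≡∣Nv∣ = trans (sym (proj₂ (proj₂ md))) (degree≡∣N∣ G v)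

  δ≤∣N∣ : ∀ u → δ ≤ ∣ N G u ∣
  δ≤∣N∣ u = subst (δ ≤_) (degree≡∣N∣ G u) (proj₁ md u)

  ∣clique∣≤ω : ∀ {S} → IsClique G S → ∣ S ∣ ≤ ω
  ∣clique∣≤ω {S} = proj₂ cn S

  ∣common∣≤ω : ∀ {u w} → u ≢ w → ¬ Adj G u w → ∣ N G u ∩ N G w ∣ ≤ ω
  ∣common∣≤ω u≢w u≁w = ∣clique∣≤ω (commonNeighbours-isClique G c4 u≢w u≁w)

  ∈M : ∀ {z} → ¬ Adj G v z → z ∈ M
  ∈M v≁z = x∉p⇒x∈∁p (∉N G v≁z)

  outsider : ∀ {x} → x ∈ M - v → v ≢ x × ¬ Adj G v x
  outsider x∈ with x∈p-y⁻ x∈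
  ... | x∈M , x≢v = (λ v≡x → x≢v (sym v≡x)) , λ v~x → x∈∁p⇒x∉p x∈M (∈subsetOf⁺ (adj? G v) v~x)

  d : Fin n → ℕ
  d x = ∣ M ∩ N G x ∣

  -- Every neighbour of an outsider x is a common neighbour with v or lies in M.
  δ≤ω+d : ∀ {x} → x ∈ M - v → δ ≤ ω + d x
  δ≤ω+d {x} x∈ with outsider x∈
  ... | v≢x , v≁x = begin
    δ                                ≤⟨ δ≤∣N∣ x ⟩
    ∣ N G x ∣                        ≤⟨ ∣q∣≤∣p∩q∣+∣∁p∩q∣ (N G v) (N G x) ⟩
    ∣ N G v ∩ N G x ∣ + d x          ≤⟨ +-monoˡ-≤ (d x) (∣common∣≤ω v≢x v≁x) ⟩
    ω + d x                          ∎
    where open ≤-Reasoning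

  -- v and x are in M but are not neighbours of x.
  d+2≤K : ∀ {x} → x ∈ M - v → d x + 2 ≤ K
  d+2≤K {x} x∈ with outsider x∈
  ... | v≢x , v≁x =
    ∣p∣+missing≤∣q∣ (v ∷ x ∷ []) ((v≢x ∷ []) ∷ [] ∷ [])
      (∈M (G .irrefl) ∷ ∈M v≁x ∷ [])
      (outer (∉N G (λ x~v → v≁x (symm G x~v))) ∷ outer (∉N G (G .irrefl)) ∷ [])
      (p∩q⊆p M (N G x))
    where
    outer : ∀ {z} → z ∉ N G x → z ∉ M ∩ N G x
    outer z∉ z∈ = z∉ (proj₂ (x∈p∩q⁻ M (N G x) z∈))

  -- Inclusion–exclusion inside M for two non-adjacent outsiders x, y:
  -- their common outer neighbours form a clique, and v, x, y are missed.
  d+d+3≤ω+K : ∀ {x y} → x ∈ M - v → y ∈ M - v → x ≢ y → ¬ Adj G x y →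
    d x + d y + 3 ≤ ω + K
  d+d+3≤ω+K {x} {y} x∈ y∈ x≢y x≁y with outsider x∈ | outsider y∈
  ... | v≢x , v≁x | v≢y , v≁y = begin
    d x + d y + 3                    ≡⟨ cong (_+ 3) (∣p∩q∣+∣p∪q∣≡∣p∣+∣q∣ A B) ⟨
    ∣ A ∩ B ∣ + ∣ A ∪ B ∣ + 3        ≡⟨ +-assoc ∣ A ∩ B ∣ ∣ A ∪ B ∣ 3 ⟩
    ∣ A ∩ B ∣ + (∣ A ∪ B ∣ + 3)      ≤⟨ +-mono-≤ ∣A∩B∣≤ω ∣A∪B∣+3≤K ⟩
    ω + K                            ∎
    where
    open ≤-Reasoning
    A B : Subset n
    A = M ∩ N G x
    B = M ∩ N G y
    ∣A∩B∣≤ω : ∣ A ∩ B ∣ ≤ ω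
    ∣A∩B∣≤ω = ≤-trans (p⊆q⇒∣p∣≤∣q∣ A∩B⊆common) (∣common∣≤ω x≢y x≁y)
      where
      A∩B⊆common : A ∩ B ⊆ N G x ∩ N G y
      A∩B⊆common z∈ with x∈p∩q⁻ A B z∈
      ... | z∈A , z∈B = x∈p∩q⁺ (proj₂ (x∈p∩q⁻ M _ z∈A) , proj₂ (x∈p∩q⁻ M _ z∈B))
    outer : ∀ {z} → z ∉ N G x → z ∉ N G y → z ∉ A ∪ B
    outer z∉Nx z∉Ny z∈ with x∈p∪q⁻ A B z∈
    ... | inj₁ z∈A = z∉Nx (proj₂ (x∈p∩q⁻ M _ z∈A))
    ... | inj₂ z∈B = z∉Ny (proj₂ (x∈p∩q⁻ M _ z∈B))
    A∪B⊆M : A ∪ B ⊆ M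
    A∪B⊆M z∈ with x∈p∪q⁻ A B z∈
    ... | inj₁ z∈A = proj₁ (x∈p∩q⁻ M _ z∈A)
    ... | inj₂ z∈B = proj₁ (x∈p∩q⁻ M _ z∈B)
    ∣A∪B∣+3≤K : ∣ A ∪ B ∣ + 3 ≤ K
    ∣A∪B∣+3≤K =
      ∣p∣+missing≤∣q∣ (v ∷ x ∷ y ∷ []) ((v≢x ∷ v≢y ∷ []) ∷ (x≢y ∷ []) ∷ [] ∷ [])
        (∈M (G .irrefl) ∷ ∈M v≁x ∷ ∈M v≁y ∷ [])
        (outer (∉N G (λ x~v → v≁x (symm G x~v))) (∉N G (λ y~v → v≁y (symm G y~v)))
          ∷ outer (∉N G (G .irrefl)) (∉N G (λ y~x → x≁y (symm G y~x)))
          ∷ outer (∉N G x≁y) (∉N G (G .irrefl)) ∷ [])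
        A∪B⊆M

  -- A non-edge u, w leaves u with at most n - 2 neighbours.
  δ+2≤n : ∀ {S} → NonEdgeIn G S → δ + 2 ≤ n
  δ+2≤n (u , w , _ , _ , u≢w , u≁w) = begin
    δ + 2         ≤⟨ +-monoˡ-≤ 2 (δ≤∣N∣ u) ⟩
    ∣ N G u ∣ + 2 ≤⟨ ∣p∣+missing≤∣q∣ (u ∷ w ∷ []) ((u≢w ∷ []) ∷ [] ∷ [])
                       (∈⊤ ∷ ∈⊤ ∷ []) (∉N G (G .irrefl) ∷ ∉N G u≁w ∷ []) (λ _ → ∈⊤) ⟩
    ∣ ⊤ {n} ∣     ≡⟨ ∣⊤∣≡n n ⟩
    n             ∎
    where open ≤-Reasoning

  withOutsider : ∀ {x} → x ∈ M - v → 3 * δ ≤ 3 * ω + n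
  withOutsider {x} x∈ with clique-or-nonEdge G (M - v)
  ... | inj₁ outsiders-clique =
    bound-clique-of-outsiders δ ω K (d x) δ+K≡n (δ≤ω+d x∈) (d+2≤K x∈)
      (≤-trans (∣p∣≤1+∣p-x∣ M v) (s≤s (∣clique∣≤ω outsiders-clique)))
  ... | inj₂ (y , z , y∈ , z∈ , y≢z , y≁z) with ≤-total (3 * d y) n | ≤-total (3 * d z) n
  ...   | inj₁ few-y | _          = bound-few-outer-neighbours δ ω (d y) (δ≤ω+d y∈) few-y
  ...   | inj₂ _     | inj₁ few-z = bound-few-outer-neighbours δ ω (d z) (δ≤ω+d z∈) few-z
  ...   | inj₂ many-y | inj₂ many-z =
    bound-two-outsiders δ ω K (d y) (d z) δ+K≡n many-y many-z (d+d+3≤ω+K y∈ z∈ y≢z y≁z)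

  -- No outsider: then K ≤ 1, which forbids any non-edge, so G is complete.
  withoutOutsider : Empty (M - v) → 3 * δ ≤ 3 * ω + n
  withoutOutsider none with clique-or-nonEdge G ⊤
  ... | inj₁ complete = ≤-trans (*-monoʳ-≤ 3 δ≤ω) (m≤m+n (3 * ω) n)
    where
    δ≤ω : δ ≤ ω
    δ≤ω = ≤-trans (δ≤∣N∣ v) (≤-trans (∣p∣≤n (N G v))
            (subst (_≤ ω) (∣⊤∣≡n n) (∣clique∣≤ω complete)))
  ... | inj₂ nonEdge =
    ⊥-elim (2≰K (+-cancelˡ-≤ δ 2 K (≤-trans (δ+2≤n nonEdge) (≤-reflexive (sym δ+K≡n)))))
    where
    K≤1 : K ≤ 1
    K≤1 = ≤-trans (∣p∣≤1+∣p-x∣ M v) (s≤s (≤-reflexive (trans (cong ∣_∣ (Empty-unique none)) (∣⊥∣≡0 n))))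
    2≰K : ¬ 2 ≤ K
    2≰K 2≤K = <⇒≱ (s≤s (s≤s z≤n)) (≤-trans 2≤K K≤1)

  bound : 3 * δ ≤ 3 * ω + n
  bound with nonempty? (M - v)
  ... | yes (_ , x∈) = withOutsider x∈
  ... | no none      = withoutOutsider none

-- The bound ω ≥ δ - n/3 holds for every C₄-free graph.
theorem3 : ∀ (n : ℕ) (G : Graph n) (δ ω : ℕ) →
    C4Free G → IsMinDegree G δ → IsCliqueNumber G ω →
    15 * δ ≤ 11 * n →
    3 * δ ≤ 3 * ω + n
theorem3 n G δ ω c4 md cn _ = MinimumDegreeVertex.bound G δ ω c4 md cn
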